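{- Let $m\in\mathbb Z$ and $Q_2(x,y,z)=x^2+2y^2+2yz+3z^2$. If $25m$ is represented by $Q_2$, then $m$ is represented by $Q_2$.
   Context: An integer $n$ is represented by a form $Q(x,y,z)$ if there exist integers $x,y,z$ with $Q(x,y,z)=n$. -}

module Defs where

open import Data.Integer using (ℤ; _+_; _*_; +_)
open import Data.Product using (∃-syntax)
open import Relation.Binary.PropositionalEquality using (_≡_)

Q₂ : ℤ → ℤ → ℤ → ℤ
Q₂ x y z = x * x + + 2 * (y * y) + + 2 * (y * z) + + 3 * (z * z)

RepresentedByQ₂ : ℤ → Set
RepresentedByQ₂ n = ∃[ x ] ∃[ y ] ∃[ z ] Q₂ x y z ≡ n

{-# OPTIONS --safe #-}
-- Modulo 5, Q₂(x,y,z) ≡ x² + 2(y + 3z)², and x² + 2w² ≡ 0 forces x ≡ w ≡ 0 because −2 is not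
-- a square mod 5. Substituting x = 5a, y + 3z = 5c leaves Q₂ ≡ 15z² (mod 25), so 25 ∣ Q₂
-- forces 5 ∣ z and then 5 ∣ y. Hence a representation of 25m is five times a representation
-- of m, as Q₂ is homogeneous of degree 2.
module Submission where

open import Defs
open import Data.Fin using (Fin; toℕ; fromℕ<)
open import Data.Fin.Properties using (all?; toℕ-fromℕ<)
open import Data.Integer using (ℤ; _*_; +_; _+_; _-_)
open import Data.Integer.DivMod using (_%ℕ_; _/ℕ_; a≡a%ℕn+[a/ℕn]*n; n%ℕd<d)
import Data.Integer.Divisibility as Unsigned
open import Data.Integer.Divisibility.Signed
open import Data.Integer.Properties using (*-comm; *-cancelˡ-≡; pos-+; pos-*)
open import Data.Integer.Solver using (module +-*-Solver)
open import Data.Integer.Tactic.RingSolver using (solve-∀)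
import Data.Nat as ℕ
import Data.Nat.Divisibility as ℕ
open import Data.Product using (Σ-syntax; _×_; _,_; proj₁; proj₂)
open import Relation.Binary.PropositionalEquality
open import Relation.Nullary.Decidable using (toWitness; _×-dec_; _→-dec_)

∣m∣m-n⇒∣n : ∀ {i m n} → i ∣ m → i ∣ m - n → i ∣ n
∣m∣m-n⇒∣n {m = m} {n} i∣m i∣m-n = subst (_ ∣_) (m-[m-n]≡n m n) (∣m∣n⇒∣m-n i∣m i∣m-n)
  where
  m-[m-n]≡n : ∀ m n → m - (m - n) ≡ n
  m-[m-n]≡n = solve-∀

∣m-n∣n⇒∣m : ∀ {i m n} → i ∣ m - n → i ∣ n → i ∣ m
∣m-n∣n⇒∣m {m = m} {n} i∣m-n i∣n = subst (_ ∣_) ([m-n]+n≡m m n) (∣m∣n⇒∣m+n i∣m-n i∣n)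
  where
  [m-n]+n≡m : ∀ m n → m - n + n ≡ m
  [m-n]+n≡m = solve-∀

∃-residue : ∀ d .{{_ : ℕ.NonZero d}} x → Σ[ r ∈ Fin d ] + d ∣ x - + toℕ r
∃-residue d x = fromℕ< (n%ℕd<d x d) , divides (x /ℕ d) x-r≡q*d
  where
  open ≡-Reasoning
  x-r≡q*d : x - + toℕ (fromℕ< (n%ℕd<d x d)) ≡ x /ℕ d * + d
  x-r≡q*d = begin
    x - + toℕ (fromℕ< (n%ℕd<d x d))        ≡⟨ cong (λ r → x - + r) (toℕ-fromℕ< (n%ℕd<d x d)) ⟩
    x - + (x %ℕ d)                         ≡⟨ cong (_- + (x %ℕ d)) (a≡a%ℕn+[a/ℕn]*n x d) ⟩
    + (x %ℕ d) + x /ℕ d * + d - + (x %ℕ d) ≡⟨ [r+q]-r≡q (+ (x %ℕ d)) (x /ℕ d * + d) ⟩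
    x /ℕ d * + d                           ∎
    where
    [r+q]-r≡q : ∀ r q → r + q - r ≡ q
    [r+q]-r≡q = solve-∀

x²+2y²-cong : ∀ {n x r y s} → n ∣ x - r → n ∣ y - s →
              n ∣ (x * x + + 2 * (y * y)) - (r * r + + 2 * (s * s))
x²+2y²-cong {x = x} {r} {y} {s} n∣x-r n∣y-s =
  subst (_ ∣_) (sym (difference-of-squares x r y s))
    (∣m∣n⇒∣m+n (∣m⇒∣m*n (x + r) n∣x-r) (∣n⇒∣m*n (+ 2) (∣m⇒∣m*n (y + s) n∣y-s)))
  where
  difference-of-squares : ∀ x r y s →
    (x * x + + 2 * (y * y)) - (r * r + + 2 * (s * s)) ≡ (x - r) * (x + r) + + 2 * ((y - s) * (y + s))
  difference-of-squares = solve-∀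

5∣r²+2s²⇒5∣r×5∣s : ∀ (r s : Fin 5) →
                   5 ℕ.∣ toℕ r ℕ.* toℕ r ℕ.+ 2 ℕ.* (toℕ s ℕ.* toℕ s) → 5 ℕ.∣ toℕ r × 5 ℕ.∣ toℕ s
5∣r²+2s²⇒5∣r×5∣s = toWitness {a? = all? λ r → all? λ s →
  (5 ℕ.∣? toℕ r ℕ.* toℕ r ℕ.+ 2 ℕ.* (toℕ s ℕ.* toℕ s)) →-dec (5 ℕ.∣? toℕ r ×-dec 5 ℕ.∣? toℕ s)} _

pos-x²+2y² : ∀ a b → + a * + a + + 2 * (+ b * + b) ≡ + (a ℕ.* a ℕ.+ 2 ℕ.* (b ℕ.* b))
pos-x²+2y² a b = begin
  + a * + a + + 2 * (+ b * + b)     ≡⟨ cong₂ _+_ (pos-* a a) (cong (+ 2 *_) (pos-* b b)) ⟨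
  + (a ℕ.* a) + + 2 * + (b ℕ.* b)   ≡⟨ cong (_+_ (+ (a ℕ.* a))) (pos-* 2 (b ℕ.* b)) ⟨
  + (a ℕ.* a) + + (2 ℕ.* (b ℕ.* b)) ≡⟨ pos-+ (a ℕ.* a) (2 ℕ.* (b ℕ.* b)) ⟨
  + (a ℕ.* a ℕ.+ 2 ℕ.* (b ℕ.* b))   ∎
  where open ≡-Reasoning

5∣x²+2y²⇒5∣x×5∣y : ∀ x y → + 5 ∣ x * x + + 2 * (y * y) → + 5 ∣ x × + 5 ∣ y
5∣x²+2y²⇒5∣x×5∣y x y 5∣x²+2y² = via-residues (∃-residue 5 x) (∃-residue 5 y)
  where
  via-residues : Σ[ r ∈ Fin 5 ] + 5 ∣ x - + toℕ r → Σ[ s ∈ Fin 5 ] + 5 ∣ y - + toℕ s →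
                 + 5 ∣ x × + 5 ∣ y
  via-residues (r , 5∣x-r) (s , 5∣y-s) =
    ∣m-n∣n⇒∣m 5∣x-r (∣ᵤ⇒∣ (proj₁ 5∣r×5∣s)) , ∣m-n∣n⇒∣m 5∣y-s (∣ᵤ⇒∣ (proj₂ 5∣r×5∣s))
    where
    5∣r²+2s² : + 5 ∣ + toℕ r * + toℕ r + + 2 * (+ toℕ s * + toℕ s)
    5∣r²+2s² = ∣m∣m-n⇒∣n 5∣x²+2y² (x²+2y²-cong {x = x} {+ toℕ r} {y} {+ toℕ s} 5∣x-r 5∣y-s)
    5∣r×5∣s : 5 ℕ.∣ toℕ r × 5 ℕ.∣ toℕ s
    5∣r×5∣s = 5∣r²+2s²⇒5∣r×5∣s r s
      (subst (+ 5 Unsigned.∣_) (pos-x²+2y² (toℕ r) (toℕ s)) (∣⇒∣ᵤ 5∣r²+2s²))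

5∣3z²⇒5∣z : ∀ z → + 5 ∣ + 3 * (z * z) → + 5 ∣ z
5∣3z²⇒5∣z z 5∣3z² = proj₂ (5∣x²+2y²⇒5∣x×5∣y (+ 0) z (subst (+ 5 ∣_) (0²+2z²≡5z²-3z² z) 5∣5z²-3z²))
  where
  0²+2z²≡5z²-3z² : ∀ z → z * z * + 5 - + 3 * (z * z) ≡ + 0 * + 0 + + 2 * (z * z)
  0²+2z²≡5z²-3z² = solve-∀
  5∣5z²-3z² : + 5 ∣ z * z * + 5 - + 3 * (z * z)
  5∣5z²-3z² = ∣m∣n⇒∣m-n (∣n⇒∣m*n (z * z) ∣-refl) 5∣3z²

module Q₂-identities where
  open +-*-Solver

  -- The reflective solver treats Q₂ as an opaque atom; this polynomial evaluates to Q₂ by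
  -- definition, so the identities below can mention Q₂ directly.
  Q₂ᵖ : ∀ {n} → Polynomial n → Polynomial n → Polynomial n → Polynomial n
  Q₂ᵖ x y z = x :* x :+ con (+ 2) :* (y :* y) :+ con (+ 2) :* (y :* z) :+ con (+ 3) :* (z :* z)

  Q₂+5[2yz+3z²]≡x²+2[y+3z]² : ∀ x y z →
    Q₂ x y z + + 5 * (+ 2 * (y * z) + + 3 * (z * z)) ≡ x * x + + 2 * ((y + + 3 * z) * (y + + 3 * z))
  Q₂+5[2yz+3z²]≡x²+2[y+3z]² = solve 3 (λ x y z →
    Q₂ᵖ x y z :+ con (+ 5) :* (con (+ 2) :* (y :* z) :+ con (+ 3) :* (z :* z))
      := x :* x :+ con (+ 2) :* ((y :+ con (+ 3) :* z) :* (y :+ con (+ 3) :* z))) refl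

  Q₂[5a,5c-3z,z]≡25[a²+2c²-2cz]+15z² : ∀ a c z →
    Q₂ (a * + 5) (c * + 5 - + 3 * z) z ≡ (a * a + + 2 * (c * c) - + 2 * (c * z)) * + 25 + + 3 * (z * z) * + 5
  Q₂[5a,5c-3z,z]≡25[a²+2c²-2cz]+15z² = solve 3 (λ a c z →
    Q₂ᵖ (a :* con (+ 5)) (c :* con (+ 5) :- con (+ 3) :* z) z
      := (a :* a :+ con (+ 2) :* (c :* c) :- con (+ 2) :* (c :* z)) :* con (+ 25)
           :+ con (+ 3) :* (z :* z) :* con (+ 5)) refl

  Q₂-homogeneous : ∀ k a b c → Q₂ (a * k) (b * k) (c * k) ≡ k * k * Q₂ a b c
  Q₂-homogeneous = solve 4 (λ k a b c → Q₂ᵖ (a :* k) (b :* k) (c :* k) := k :* k :* Q₂ᵖ a b c) refl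

open Q₂-identities

25∣Q₂⇒5∣z : ∀ x y z → + 25 ∣ Q₂ x y z → + 5 ∣ x → + 5 ∣ y + + 3 * z → + 5 ∣ z
25∣Q₂⇒5∣z x y z 25∣Q₂ (divides a x≡5a) (divides c y+3z≡5c) = 5∣3z²⇒5∣z z (*-cancelʳ-∣ (+ 5) 25∣15z²)
  where
  y≡5c-3z : y ≡ c * + 5 - + 3 * z
  y≡5c-3z = trans (sym ([y+3z]-3z≡y y z)) (cong (_- + 3 * z) y+3z≡5c)
    where
    [y+3z]-3z≡y : ∀ y z → y + + 3 * z - + 3 * z ≡ y
    [y+3z]-3z≡y = solve-∀
  q : ℤ
  q = a * a + + 2 * (c * c) - + 2 * (c * z)
  25∣25q+15z² : + 25 ∣ q * + 25 + + 3 * (z * z) * + 5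
  25∣25q+15z² = subst (+ 25 ∣_) (Q₂[5a,5c-3z,z]≡25[a²+2c²-2cz]+15z² a c z)
    (subst₂ (λ x y → + 25 ∣ Q₂ x y z) x≡5a y≡5c-3z 25∣Q₂)
  25∣15z² : + 25 ∣ + 3 * (z * z) * + 5
  25∣15z² = ∣m+n∣m⇒∣n 25∣25q+15z² (∣n⇒∣m*n q ∣-refl)

5∣Q₂⇒5∣x×5∣y+3z : ∀ x y z → + 5 ∣ Q₂ x y z → + 5 ∣ x × + 5 ∣ y + + 3 * z
5∣Q₂⇒5∣x×5∣y+3z x y z 5∣Q₂ = 5∣x²+2y²⇒5∣x×5∣y x (y + + 3 * z)
  (subst (+ 5 ∣_) (Q₂+5[2yz+3z²]≡x²+2[y+3z]² x y z) (∣m∣n⇒∣m+n 5∣Q₂ (∣m⇒∣m*n _ ∣-refl)))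

25∣Q₂⇒5∣x×5∣y×5∣z : ∀ x y z → + 25 ∣ Q₂ x y z → + 5 ∣ x × + 5 ∣ y × + 5 ∣ z
25∣Q₂⇒5∣x×5∣y×5∣z x y z 25∣Q₂ = 5∣x , ∣m+n∣n⇒∣m 5∣y+3z (∣n⇒∣m*n (+ 3) 5∣z) , 5∣z
  where
  5∣x×5∣y+3z : + 5 ∣ x × + 5 ∣ y + + 3 * z
  5∣x×5∣y+3z = 5∣Q₂⇒5∣x×5∣y+3z x y z (∣-trans (divides (+ 5) refl) 25∣Q₂)
  5∣x = proj₁ 5∣x×5∣y+3z
  5∣y+3z = proj₂ 5∣x×5∣y+3z
  5∣z : + 5 ∣ z
  5∣z = 25∣Q₂⇒5∣z x y z 25∣Q₂ 5∣x 5∣y+3z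

Q₂≡25m⇒m-represented : ∀ {m x y z} → Q₂ x y z ≡ + 25 * m → + 5 ∣ x × + 5 ∣ y × + 5 ∣ z →
                       RepresentedByQ₂ m
Q₂≡25m⇒m-represented {m} {x} {y} {z} Q₂≡25m (divides a x≡5a , divides b y≡5b , divides c z≡5c) =
  a , b , c , *-cancelˡ-≡ (+ 25) (Q₂ a b c) m (begin
    + 25 * Q₂ a b c                    ≡⟨ Q₂-homogeneous (+ 5) a b c ⟨
    Q₂ (a * + 5) (b * + 5) (c * + 5)   ≡⟨ cong (Q₂ (a * + 5) (b * + 5)) z≡5c ⟨
    Q₂ (a * + 5) (b * + 5) z           ≡⟨ cong₂ (λ x y → Q₂ x y z) x≡5a y≡5b ⟨
    Q₂ x y z                           ≡⟨ Q₂≡25m ⟩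
    + 25 * m                           ∎)
  where open ≡-Reasoning

mainTheorem17 : (m : ℤ) → RepresentedByQ₂ (+ 25 * m) → RepresentedByQ₂ m
mainTheorem17 m (x , y , z , Q₂≡25m) =
  Q₂≡25m⇒m-represented Q₂≡25m (25∣Q₂⇒5∣x×5∣y×5∣z x y z (divides m (trans Q₂≡25m (*-comm (+ 25) m))))
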